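{- Let $\mathbb F$ be a field of characteristic $0$ and $d\ge1$ an integer. The graph parameter $\operatorname{ec}_d$, as a function on simple graphs, is not expressible as a graph homomorphism function over $\mathbb F$; that is, there is no $\mathbb F$-weighted graph $H$ such that $\operatorname{ec}_d(G)=\hom(G,H)$ for every simple graph $G$.
   Context: For a graph $G$, $\operatorname{ec}_d(G)\in\mathbb F$ is the number (times $1\in\mathbb F$) of proper edge $d$-colorings of $G$, i.e. maps $c:E(G)\to\{1,\dots,d\}$ such that any two distinct edges sharing an endpoint receive different colors. An $\mathbb F$-weighted graph $H$ is given by $q=|V(H)|\ge0$, vertex weights $\alpha_1,\dots,\alpha_q\in\mathbb F\setminus\{0\}$ and a symmetric matrix $B=(\beta_{ij})\in\mathbb F^{q\times q}$; $\hom(G,H)=\sum_{\phi:V(G)\to[q]}\prod_{u\in V(G)}\alpha_{\phi(u)}\prod_{uv\in E(G)}\beta_{\phi(u)\phi(v)}$ (empty products equal $1$). -}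

module Defs where

open import Level using (Level; _⊔_; suc)
open import Algebra.Bundles using (CommutativeRing)
open import Data.Nat as ℕ using (ℕ; zero) renaming (suc to sucℕ)
open import Data.Fin as Fin using (Fin; toℕ)
open import Data.Fin.Properties using () renaming (_≟_ to _≟ᶠ_)
open import Data.Bool using (Bool; true; false; _∧_; _∨_; not; if_then_else_)
open import Data.List using (List; []; _∷_; map; concatMap; filter; length; foldr; allFin)
open import Data.Vec.Functional using () renaming (_∷_ to _∷ᶠ_)
open import Data.Product using (Σ; _×_; _,_; proj₁; proj₂)
open import Relation.Nullary using (¬_; does)
open import Relation.Binary.PropositionalEquality using (_≡_)

record Field (c ℓ : Level) : Set (Level.suc (c ⊔ ℓ)) where
  field
    commutativeRing : CommutativeRing c ℓ
  open CommutativeRing commutativeRing public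
  field
    1≉0     : ¬ (1# ≈ 0#)
    inverse : ∀ x → ¬ (x ≈ 0#) → Σ Carrier (λ y → x * y ≈ 1#)

module _ {c ℓ : Level} (F : Field c ℓ) where
  open Field F

  natF : ℕ → Carrier
  natF zero = 0#
  natF (sucℕ n) = 1# + natF n

  CharZero : Set ℓ
  CharZero = ∀ (n : ℕ) → ¬ (natF (sucℕ n) ≈ 0#)

  sumF : List Carrier → Carrier
  sumF = foldr _+_ 0#

  prodF : List Carrier → Carrier
  prodF = foldr _*_ 1#

record SimpleGraph : Set where
  field
    n      : ℕ
    adj    : Fin n → Fin n → Bool
    sym    : ∀ i j → adj i j ≡ adj j i
    irrefl : ∀ i → adj i i ≡ false

allFuns : (m k : ℕ) → List (Fin m → Fin k)
allFuns zero k = (λ ()) ∷ []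
allFuns (sucℕ m) k = concatMap (λ f → map (λ x → x ∷ᶠ f) (allFin k)) (allFuns m k)

allᵇ : ∀ {A : Set} → (A → Bool) → List A → Bool
allᵇ p = foldr (λ x b → p x ∧ b) true

_=ᶠ_ : ∀ {n} → Fin n → Fin n → Bool
i =ᶠ j = does (i ≟ᶠ j)

module _ (G : SimpleGraph) where
  open SimpleGraph G

  edges : List (Fin n × Fin n)
  edges = filter (λ e → Data.Bool.T? (ℕ._<ᵇ_ (toℕ (proj₁ e)) (toℕ (proj₂ e)) ∧ adj (proj₁ e) (proj₂ e)))
                 (concatMap (λ i → map (λ j → (i , j)) (allFin n)) (allFin n))

  m : ℕ
  m = length edges

  edgeAt : Fin m → Fin n × Fin n
  edgeAt = Data.List.lookup edges

  shareᵇ : Fin n × Fin n → Fin n × Fin n → Bool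
  shareᵇ (a , b) (c , d) = (a =ᶠ c) ∨ (a =ᶠ d) ∨ (b =ᶠ c) ∨ (b =ᶠ d)

  -- proper edge colouring c : E(G) → {1..d}: distinct edges sharing an
  -- endpoint get different colours
  properᵇ : ∀ {d} → (Fin m → Fin d) → Bool
  properᵇ col = allᵇ (λ e → allᵇ (λ f →
      not (not (e =ᶠ f) ∧ shareᵇ (edgeAt e) (edgeAt f)) ∨ not (col e =ᶠ col f))
      (allFin m)) (allFin m)

  ecℕ : ℕ → ℕ
  ecℕ d = length (filter (λ col → Data.Bool.T? (properᵇ col)) (allFuns m d))

ec : ∀ {c ℓ} (F : Field c ℓ) → ℕ → SimpleGraph → Field.Carrier F
ec F d G = natF F (ecℕ G d)

record WeightedGraph {c ℓ} (F : Field c ℓ) : Set (c ⊔ ℓ) where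
  open Field F
  field
    q     : ℕ
    α     : Fin q → Carrier
    α≉0   : ∀ i → ¬ (α i ≈ 0#)
    β     : Fin q → Fin q → Carrier
    β-sym : ∀ i j → β i j ≈ β j i

hom : ∀ {c ℓ} (F : Field c ℓ) → SimpleGraph → WeightedGraph F → Field.Carrier F
hom F G H =
  sumF F (map (λ φ → Field._*_ F
                 (prodF F (map (λ u → α (φ u)) (allFin n)))
                 (prodF F (map (λ e → β (φ (proj₁ e)) (φ (proj₂ e))) (edges G))))
              (allFuns n q))
  where
    open SimpleGraph G
    open WeightedGraph H

module Submission where

-- Test the parameter on the stars K₁,ₖ.  A homomorphism from K₁,ₖ sends the centre to some x and
-- the k leaves independently, so hom(K₁,ₖ, H) = Σₓ αₓ sₓᵏ with sₓ = Σ_y α_y β_xy: a weighted power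
-- sum in k.  On the other hand ec_d(K₁,ₖ) is d for k = 1 and 0 for k > d, since the k edges of a
-- star pairwise share the centre.  A weighted power sum Σᵢ wᵢ tᵢᵏ that vanishes for all large k
-- vanishes for all k ≥ 1 (induct on the number of nodes: subtracting t₀ times the sum at k from the
-- sum at k + 1 kills node 0), contradicting ec_d(K₁,₁) = d ≠ 0 in characteristic 0.

open import Defs
open import Level using (Level)
open import Algebra.Bundles using (CommutativeSemiring)
open import Data.Bool using (Bool; true; false; _∧_; _∨_; not; T; T?)
open import Data.Bool.Properties using (∧-zeroʳ; T-∧)
open import Data.Fin using (Fin; zero; suc; toℕ)
open import Data.Fin.Properties using (pigeonhole; <⇒≢) renaming (_≟_ to _≟ᶠ_)
open import Data.List using (List; []; _∷_; map; concatMap; tabulate; filter; length; allFin; foldr; _++_)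
open import Data.List.Properties
  using (filter-++; filter-all; filter-none; length-tabulate; length-++; length-map; ++-identityʳ; map-tabulate; map-++; map-∘)
open import Data.List.Membership.Propositional using (_∈_)
open import Data.List.Membership.Propositional.Properties using (∈-lookup; ∈-allFin; ∈-tabulate⁻)
open import Data.List.Relation.Unary.Any using (here; there)
import Data.List.Relation.Unary.All as All
open import Data.Nat as ℕ using (ℕ; _<_; _<ᵇ_; _≥_; s≤s)
import Data.Nat.Properties as ℕₚ
open import Data.Product using (Σ; _×_; _,_; proj₁; proj₂)
open import Data.Unit using (tt)
import Data.Vec.Functional as Vector
open import Data.Vec.Functional using () renaming (_∷_ to _∷ᶠ_)
open import Effect.Monad using (RawMonad)
open import Function using (_∘_; id; Equivalence)
open import Relation.Nullary using (¬_; yes; no)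
open import Relation.Nullary.Decidable using (dec-true; dec-false; ¬¬-excluded-middle)
open import Relation.Nullary.Negation using (¬¬-Monad; ¬¬-map)
open import Relation.Binary.PropositionalEquality as ≡ using (_≡_; _≢_)

foldr-tabulate : ∀ {a b} {A : Set a} {B : Set b} (f : A → B → B) (z : B) {n} (h : Fin n → A) →
                 foldr f z (tabulate h) ≡ Vector.foldr f z h
foldr-tabulate f z {ℕ.zero}  h = ≡.refl
foldr-tabulate f z {ℕ.suc n} h = ≡.cong (f (h zero)) (foldr-tabulate f z (h ∘ suc))

foldr-map-allFin : ∀ {a b} {A : Set a} {B : Set b} (f : A → B → B) (z : B) {n} (h : Fin n → A) →
                   foldr f z (map h (allFin n)) ≡ Vector.foldr f z h
foldr-map-allFin f z h = ≡.trans (≡.cong (foldr f z) (map-tabulate id h)) (foldr-tabulate f z h)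

length-concatMap-const : ∀ {A B : Set} (f : A → List B) {c} → (∀ x → length (f x) ≡ c) →
                         ∀ xs → length (concatMap f xs) ≡ length xs ℕ.* c
length-concatMap-const f hyp []       = ≡.refl
length-concatMap-const f hyp (x ∷ xs) =
  ≡.trans (length-++ (f x)) (≡.cong₂ ℕ._+_ (hyp x) (length-concatMap-const f hyp xs))

length-allFuns : ∀ m k → length (allFuns m k) ≡ k ℕ.^ m
length-allFuns ℕ.zero    k = ≡.refl
length-allFuns (ℕ.suc m) k = begin
  length (allFuns (ℕ.suc m) k)  ≡⟨ length-concatMap-const _ (λ _ → ≡.trans (length-map _ (allFin k)) (length-tabulate _))
                                                          (allFuns m k) ⟩
  length (allFuns m k) ℕ.* k    ≡⟨ ≡.cong (ℕ._* k) (length-allFuns m k) ⟩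
  k ℕ.^ m ℕ.* k                 ≡⟨ ℕₚ.*-comm (k ℕ.^ m) k ⟩
  k ℕ.^ ℕ.suc m                 ∎
  where open ≡.≡-Reasoning

allᵇ-∈ : ∀ {A : Set} (p : A → Bool) {xs x} → T (allᵇ p xs) → x ∈ xs → T (p x)
allᵇ-∈ p {y ∷ ys} t (here ≡.refl) = proj₁ (Equivalence.to T-∧ t)
allᵇ-∈ p {y ∷ ys} t (there x∈) = allᵇ-∈ p (proj₂ (Equivalence.to T-∧ t)) x∈

adjacent-colours-differ : ∀ G {d} (col : Fin (m G) → Fin d) → T (properᵇ G col) →
  ∀ {e f} → e ≢ f → shareᵇ G (edgeAt G e) (edgeAt G f) ≡ true → col e ≢ col f
adjacent-colours-differ G col proper {e} {f} e≢f shared col-eq =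
  violates (allᵇ-∈ _ (allᵇ-∈ _ proper (∈-allFin e)) (∈-allFin f))
  where
  violates : ¬ T (not (not (e =ᶠ f) ∧ shareᵇ G (edgeAt G e) (edgeAt G f)) ∨ not (col e =ᶠ col f))
  violates rewrite dec-false (e ≟ᶠ f) e≢f | shared | dec-true (col e ≟ᶠ col f) col-eq = λ ()

adj-star : ∀ {k} → Fin (ℕ.suc k) → Fin (ℕ.suc k) → Bool
adj-star zero    zero    = false
adj-star zero    (suc _) = true
adj-star (suc _) zero    = true
adj-star (suc _) (suc _) = false

star : ℕ → SimpleGraph
star k = record { n = ℕ.suc k ; adj = adj-star ; sym = adj-star-sym ; irrefl = adj-star-irrefl }
  where
  adj-star-sym : ∀ i j → adj-star i j ≡ adj-star j i
  adj-star-sym zero    zero    = ≡.refl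
  adj-star-sym zero    (suc _) = ≡.refl
  adj-star-sym (suc _) zero    = ≡.refl
  adj-star-sym (suc _) (suc _) = ≡.refl
  adj-star-irrefl : ∀ i → adj-star i i ≡ false
  adj-star-irrefl zero    = ≡.refl
  adj-star-irrefl (suc _) = ≡.refl

spokes : ∀ k → List (Fin (ℕ.suc k) × Fin (ℕ.suc k))
spokes k = tabulate (λ j → (zero , suc j))

module _ (k : ℕ) where
  private
    IsEdge? : (e : Fin (ℕ.suc k) × Fin (ℕ.suc k)) → _
    IsEdge? (i , j) = T? ((toℕ i <ᵇ toℕ j) ∧ adj-star i j)

    row : Fin (ℕ.suc k) → List (Fin (ℕ.suc k) × Fin (ℕ.suc k))
    row i = map (i ,_) (allFin (ℕ.suc k))

    centre-row : ∀ {m} (g : Fin m → Fin k) →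
                 filter IsEdge? (map (zero ,_) (tabulate (suc ∘ g))) ≡ tabulate (λ j → (zero , suc (g j)))
    centre-row {ℕ.zero}  g = ≡.refl
    centre-row {ℕ.suc m} g = ≡.cong ((zero , suc (g zero)) ∷_) (centre-row (g ∘ suc))

    leaf-row : ∀ i xs → filter IsEdge? (map (suc i ,_) xs) ≡ []
    leaf-row i []            = ≡.refl
    leaf-row i (zero  ∷ xs)  = leaf-row i xs
    leaf-row i (suc j ∷ xs) rewrite ∧-zeroʳ (toℕ i <ᵇ toℕ j) = leaf-row i xs

    leaf-rows : ∀ {m} (g : Fin m → Fin k) → filter IsEdge? (concatMap row (tabulate (suc ∘ g))) ≡ []
    leaf-rows {ℕ.zero}  g = ≡.refl
    leaf-rows {ℕ.suc m} g = ≡.trans (filter-++ IsEdge? (row (suc (g zero))) _)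
                                    (≡.cong₂ _++_ (leaf-row (g zero) (allFin (ℕ.suc k))) (leaf-rows (g ∘ suc)))

  edges-star : edges (star k) ≡ spokes k
  edges-star = ≡.trans (filter-++ IsEdge? (row zero) (concatMap row (tabulate suc)))
                       (≡.trans (≡.cong₂ _++_ (centre-row id) (leaf-rows id)) (++-identityʳ _))

  edge-count-star : m (star k) ≡ k
  edge-count-star = ≡.trans (≡.cong length edges-star) (length-tabulate _)

  centre-endpoint : ∀ e → proj₁ (edgeAt (star k) e) ≡ zero
  centre-endpoint e with ∈-tabulate⁻ (≡.subst (edgeAt (star k) e ∈_) edges-star (∈-lookup e))
  ... | _ , e≡ = ≡.cong proj₁ e≡

ecℕ-star-one : ∀ d → ecℕ (star 1) d ≡ d
ecℕ-star-one d = begin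
  ecℕ (star 1) d         ≡⟨ ≡.cong length (filter-all (T? ∘ properᵇ (star 1))
                                                       (All.universal (λ _ → tt) (allFuns 1 d))) ⟩
  length (allFuns 1 d)   ≡⟨ length-allFuns 1 d ⟩
  d ℕ.* 1                ≡⟨ ℕₚ.*-identityʳ d ⟩
  d                      ∎
  where open ≡.≡-Reasoning

ecℕ-star-overfull : ∀ {d k} → d < k → ecℕ (star k) d ≡ 0
ecℕ-star-overfull {d} {k} d<k =
  ≡.cong length (filter-none (T? ∘ properᵇ (star k)) (All.universal no-proper (allFuns (m (star k)) d)))
  where
  shared : ∀ e f → shareᵇ (star k) (edgeAt (star k) e) (edgeAt (star k) f) ≡ true
  shared e f rewrite centre-endpoint k e | centre-endpoint k f = ≡.refl
  no-proper : ∀ col → ¬ T (properᵇ (star k) col)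
  no-proper col proper with pigeonhole (≡.subst (d <_) (≡.sym (edge-count-star k)) d<k) col
  ... | e , f , e<f , col-eq = adjacent-colours-differ (star k) col proper (<⇒≢ e<f) (shared e f) col-eq

module ListSums {c ℓ} (R : CommutativeSemiring c ℓ) where
  open CommutativeSemiring R hiding (zero)
  open import Algebra.Properties.Semiring.Sum semiring using (sum; ∑-distrib-+; *-distribʳ-sum; sum-replicate-zero)
  open import Algebra.Properties.CommutativeMonoid.Sum *-commutativeMonoid
    using () renaming (sum to ∏)
  open import Relation.Binary.Reasoning.Setoid setoid

  sumˡ : List Carrier → Carrier
  sumˡ = foldr _+_ 0#

  sumˡ-cong : ∀ {A : Set} (xs : List A) {f g : A → Carrier} → (∀ x → f x ≈ g x) →
              sumˡ (map f xs) ≈ sumˡ (map g xs)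
  sumˡ-cong []       f≈g = refl
  sumˡ-cong (x ∷ xs) f≈g = +-cong (f≈g x) (sumˡ-cong xs f≈g)

  sumˡ-++ : ∀ xs ys → sumˡ (xs ++ ys) ≈ sumˡ xs + sumˡ ys
  sumˡ-++ []       ys = sym (+-identityˡ _)
  sumˡ-++ (x ∷ xs) ys = trans (+-congˡ (sumˡ-++ xs ys)) (sym (+-assoc _ _ _))

  sumˡ-concatMap : ∀ {A B : Set} (g : B → Carrier) (h : A → List B) xs →
                   sumˡ (map g (concatMap h xs)) ≈ sumˡ (map (λ x → sumˡ (map g (h x))) xs)
  sumˡ-concatMap g h []       = refl
  sumˡ-concatMap g h (x ∷ xs) = begin
    sumˡ (map g (h x ++ concatMap h xs))                   ≡⟨ ≡.cong sumˡ (map-++ g (h x) (concatMap h xs)) ⟩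
    sumˡ (map g (h x) ++ map g (concatMap h xs))            ≈⟨ sumˡ-++ (map g (h x)) _ ⟩
    sumˡ (map g (h x)) + sumˡ (map g (concatMap h xs))      ≈⟨ +-congˡ (sumˡ-concatMap g h xs) ⟩
    sumˡ (map g (h x)) + sumˡ (map (λ x → sumˡ (map g (h x))) xs) ∎

  *-distribˡ-sumˡ : ∀ {A : Set} a (f : A → Carrier) xs → a * sumˡ (map f xs) ≈ sumˡ (map (λ x → a * f x) xs)
  *-distribˡ-sumˡ a f []       = zeroʳ a
  *-distribˡ-sumˡ a f (x ∷ xs) = trans (distribˡ a _ _) (+-congˡ (*-distribˡ-sumˡ a f xs))

  sumˡ-∑-comm : ∀ {A : Set} {q} (G : A → Fin q → Carrier) xs →
                sumˡ (map (λ x → sum (G x)) xs) ≈ sum (λ i → sumˡ (map (λ x → G x i) xs))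
  sumˡ-∑-comm {q = q} G []       = sym (sum-replicate-zero q)
  sumˡ-∑-comm         G (x ∷ xs) = trans (+-congˡ (sumˡ-∑-comm G xs)) (sym (∑-distrib-+ (G x) _))

  sumˡ-allFuns-suc : ∀ {k q} (g : (Fin (ℕ.suc k) → Fin q) → Carrier) →
    sumˡ (map g (allFuns (ℕ.suc k) q)) ≈ sumˡ (map (λ f → sum (λ x → g (x ∷ᶠ f))) (allFuns k q))
  sumˡ-allFuns-suc {k} {q} g = begin
    sumˡ (map g (allFuns (ℕ.suc k) q))                               ≈⟨ sumˡ-concatMap g extensions (allFuns k q) ⟩
    sumˡ (map (λ f → sumˡ (map g (extensions f))) (allFuns k q))       ≈⟨ sumˡ-cong (allFuns k q) extensions-sum ⟩
    sumˡ (map (λ f → sum (λ x → g (x ∷ᶠ f))) (allFuns k q))            ∎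
    where
    extensions : (Fin k → Fin q) → List (Fin (ℕ.suc k) → Fin q)
    extensions f = map (_∷ᶠ f) (allFin q)
    extensions-sum : ∀ f → sumˡ (map g (extensions f)) ≈ sum (λ x → g (x ∷ᶠ f))
    extensions-sum f = reflexive (≡.trans (≡.cong sumˡ (≡.sym (map-∘ (allFin q))))
                                          (foldr-map-allFin _+_ 0# (λ x → g (x ∷ᶠ f))))

  sumˡ-allFuns-∏ : ∀ k {q} (g : Fin k → Fin q → Carrier) →
                   sumˡ (map (λ f → ∏ (λ j → g j (f j))) (allFuns k q)) ≈ ∏ (λ j → sum (g j))
  sumˡ-allFuns-∏ ℕ.zero    g = +-identityʳ 1#
  sumˡ-allFuns-∏ (ℕ.suc k) {q} g = begin
    sumˡ (map (λ f → ∏ (λ j → g j (f j))) (allFuns (ℕ.suc k) q))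
      ≈⟨ sumˡ-allFuns-suc (λ f → ∏ (λ j → g j (f j))) ⟩
    sumˡ (map (λ f → sum (λ x → g zero x * rest f)) (allFuns k q))
      ≈⟨ sumˡ-cong (allFuns k q) (λ f → sym (*-distribʳ-sum (rest f) (g zero))) ⟩
    sumˡ (map (λ f → sum (g zero) * rest f) (allFuns k q))
      ≈⟨ *-distribˡ-sumˡ (sum (g zero)) rest (allFuns k q) ⟨
    sum (g zero) * sumˡ (map rest (allFuns k q))
      ≈⟨ *-congˡ (sumˡ-allFuns-∏ k (g ∘ suc)) ⟩
    ∏ (λ j → sum (g j)) ∎
    where
    rest : (Fin k → Fin q) → Carrier
    rest f = ∏ (λ j → g (suc j) (f j))

module _ {c ℓ} (F : Field c ℓ) where
  open Field F hiding (zero)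
  open import Algebra.Properties.Semiring.Exp semiring using (_^_)
  open import Algebra.Properties.Semiring.Sum semiring using (sum; ∑-distrib-+; *-distribˡ-sum; sum-cong-≋)
  open import Algebra.Properties.CommutativeMonoid.Sum *-commutativeMonoid
    using () renaming (sum to ∏; ∑-distrib-+ to ∏-distrib-*; sum-replicate to ∏-const)
  open ListSums commutativeSemiring
  open RawMonad (¬¬-Monad {ℓ})
  open import Algebra.Properties.AbelianGroup +-abelianGroup using (xyx⁻¹≈y)
  open import Relation.Binary.Reasoning.Setoid setoid

  *-zero-cancelˡ : ∀ {x y} → ¬ x ≈ 0# → x * y ≈ 0# → y ≈ 0#
  *-zero-cancelˡ {x} {y} x≉0 xy≈0 = begin
    y              ≈⟨ *-identityˡ y ⟨
    1# * y         ≈⟨ *-congʳ (trans (*-comm x⁻¹ x) xx⁻¹≈1) ⟨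
    (x⁻¹ * x) * y  ≈⟨ *-assoc x⁻¹ x y ⟩
    x⁻¹ * (x * y)  ≈⟨ *-congˡ xy≈0 ⟩
    x⁻¹ * 0#       ≈⟨ zeroʳ x⁻¹ ⟩
    0#             ∎
    where
    x⁻¹ : Carrier
    x⁻¹ = proj₁ (inverse x x≉0)
    xx⁻¹≈1 : x * x⁻¹ ≈ 1#
    xx⁻¹≈1 = proj₂ (inverse x x≉0)

  powerSum : ∀ {q} → (Fin q → Carrier) → (Fin q → Carrier) → ℕ → Carrier
  powerSum w t k = sum (λ i → w i * t i ^ k)

  powerSum-drop-head : ∀ {q} (w t : Fin (ℕ.suc q) → Carrier) k → w zero * t zero ^ k ≈ 0# →
                       powerSum w t k ≈ powerSum (w ∘ suc) (t ∘ suc) k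
  powerSum-drop-head w t k head≈0 = trans (+-congʳ head≈0) (+-identityˡ _)

  *-split-factor : ∀ w t s p → w * (t * p) ≈ s * (w * p) + (w * (t + - s)) * p
  *-split-factor w t s p = begin
    w * (t * p)                                ≈⟨ *-assoc w t p ⟨
    (w * t) * p                                ≈⟨ *-congʳ (*-congˡ t≈s+[t-s]) ⟩
    (w * (s + (t + - s))) * p                  ≈⟨ *-congʳ (distribˡ w s (t + - s)) ⟩
    (w * s + w * (t + - s)) * p                ≈⟨ distribʳ p (w * s) (w * (t + - s)) ⟩
    (w * s) * p + (w * (t + - s)) * p          ≈⟨ +-congʳ (trans (*-congʳ (*-comm w s)) (*-assoc s w p)) ⟩
    s * (w * p) + (w * (t + - s)) * p          ∎
    where
    t≈s+[t-s] : t ≈ s + (t + - s)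
    t≈s+[t-s] = sym (trans (sym (+-assoc s t (- s))) (xyx⁻¹≈y s t))

  powerSum-shift : ∀ {q} (w t : Fin q → Carrier) s k →
    powerSum w t (ℕ.suc k) ≈ s * powerSum w t k + powerSum (λ i → w i * (t i + - s)) t k
  powerSum-shift w t s k = begin
    powerSum w t (ℕ.suc k)
      ≈⟨ sum-cong-≋ (λ i → *-split-factor (w i) (t i) s (t i ^ k)) ⟩
    sum (λ i → s * (w i * t i ^ k) + (w i * (t i + - s)) * t i ^ k)
      ≈⟨ ∑-distrib-+ (λ i → s * (w i * t i ^ k)) _ ⟩
    sum (λ i → s * (w i * t i ^ k)) + powerSum (λ i → w i * (t i + - s)) t k
      ≈⟨ +-congʳ (*-distribˡ-sum s (λ i → w i * t i ^ k)) ⟨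
    s * powerSum w t k + powerSum (λ i → w i * (t i + - s)) t k ∎

  geometric-vanish : ∀ {a : ℕ → Carrier} {r} → ¬ r ≈ 0# → (∀ k → ¬ ¬ (a (ℕ.suc k) ≈ r * a k)) →
                     ∀ N → (∀ j → ¬ ¬ (a (N ℕ.+ j) ≈ 0#)) → ∀ k → ¬ ¬ (a k ≈ 0#)
  geometric-vanish r≉0 step ℕ.zero    tail≈0 = tail≈0
  geometric-vanish r≉0 step (ℕ.suc N) tail≈0 = geometric-vanish r≉0 step N λ j → do
    next≈0   ← tail≈0 j
    next≈r*a ← step (N ℕ.+ j)
    pure (*-zero-cancelˡ r≉0 (trans (sym next≈r*a) next≈0))

  -- Equality in F is not decidable, so the case split on t₀ ≈ 0 is only available under ¬ ¬;
  -- that is enough, since the vanishing is used to refute something.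
  powerSum-vanishes : ∀ {q} (w t : Fin q → Carrier) N → (∀ j → powerSum w t (ℕ.suc (N ℕ.+ j)) ≈ 0#) →
                      ∀ k → ¬ ¬ (powerSum w t (ℕ.suc k) ≈ 0#)
  powerSum-vanishes {ℕ.zero}  w t N tail≈0 k = pure refl
  powerSum-vanishes {ℕ.suc q} w t N tail≈0 k = ¬¬-excluded-middle >>= λ where
      (yes t₀≈0) → ¬¬-map (trans (drop-node₀ t₀≈0 k))
                          (powerSum-vanishes (w ∘ suc) (t ∘ suc) N
                            (λ j → trans (sym (drop-node₀ t₀≈0 (N ℕ.+ j))) (tail≈0 j)) k)
      (no t₀≉0)  → geometric-vanish t₀≉0 recurrence N (pure ∘ tail≈0) k
    where
    t₀ : Carrier
    t₀ = t zero

    drop-node₀ : t₀ ≈ 0# → ∀ k → powerSum w t (ℕ.suc k) ≈ powerSum (w ∘ suc) (t ∘ suc) (ℕ.suc k)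
    drop-node₀ t₀≈0 k = powerSum-drop-head w t (ℕ.suc k)
      (trans (*-congˡ (trans (*-congʳ t₀≈0) (zeroˡ _))) (zeroʳ (w zero)))

    w′ : Fin q → Carrier
    w′ i = w (suc i) * (t (suc i) + - t₀)

    shift : ∀ k → powerSum w t (ℕ.suc k) ≈ t₀ * powerSum w t k + powerSum w′ (t ∘ suc) k
    shift k = trans (powerSum-shift w t t₀ k) (+-congˡ (powerSum-drop-head (λ i → w i * (t i + - t₀)) t k
      (trans (*-congʳ (trans (*-congˡ (-‿inverseʳ t₀)) (zeroʳ (w zero)))) (zeroˡ _))))

    tail′≈0 : ∀ j → powerSum w′ (t ∘ suc) (ℕ.suc (N ℕ.+ j)) ≈ 0#
    tail′≈0 j = begin
      powerSum w′ (t ∘ suc) n                      ≈⟨ +-identityˡ _ ⟨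
      0# + powerSum w′ (t ∘ suc) n                 ≈⟨ +-congʳ (trans (*-congˡ (tail≈0 j)) (zeroʳ t₀)) ⟨
      t₀ * powerSum w t n + powerSum w′ (t ∘ suc) n ≈⟨ shift n ⟨
      powerSum w t (ℕ.suc n)                       ≈⟨ ≡.subst (λ i → powerSum w t (ℕ.suc i) ≈ 0#) (ℕₚ.+-suc N j) (tail≈0 (ℕ.suc j)) ⟩
      0#                                           ∎
      where
      n : ℕ
      n = ℕ.suc (N ℕ.+ j)

    recurrence : ∀ k → ¬ ¬ (powerSum w t (ℕ.suc (ℕ.suc k)) ≈ t₀ * powerSum w t (ℕ.suc k))
    recurrence k = ¬¬-map (λ p′≈0 → trans (shift (ℕ.suc k)) (trans (+-congˡ p′≈0) (+-identityʳ _)))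
                          (powerSum-vanishes w′ (t ∘ suc) N tail′≈0 k)

  weightedDegree : (H : WeightedGraph F) → Fin (WeightedGraph.q H) → Carrier
  weightedDegree H x = sum (λ y → α y * β x y)
    where open WeightedGraph H

  hom-star : ∀ k (H : WeightedGraph F) → hom F (star k) H ≈ powerSum (WeightedGraph.α H) (weightedDegree H) k
  hom-star k H = begin
    hom F (star k) H                                               ≡⟨ ≡.cong (λ es → sumˡ (map (summand es) maps)) (edges-star k) ⟩
    sumˡ (map (summand (spokes k)) maps)                           ≈⟨ sumˡ-allFuns-suc (summand (spokes k)) ⟩
    sumˡ (map (λ f → sum (λ x → summand (spokes k) (x ∷ᶠ f))) (allFuns k q))
                                                                   ≈⟨ sumˡ-cong (allFuns k q) (λ f → sum-cong-≋ (summand-factors f)) ⟩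
    sumˡ (map (λ f → sum (λ x → α x * leaves x f)) (allFuns k q))  ≈⟨ sumˡ-∑-comm (λ f x → α x * leaves x f) (allFuns k q) ⟩
    sum (λ x → sumˡ (map (λ f → α x * leaves x f) (allFuns k q)))  ≈⟨ sum-cong-≋ centred-at ⟩
    powerSum α (weightedDegree H) k                                ∎
    where
    open WeightedGraph H

    maps : List (Fin (ℕ.suc k) → Fin q)
    maps = allFuns (ℕ.suc k) q

    summand : List (Fin (ℕ.suc k) × Fin (ℕ.suc k)) → (Fin (ℕ.suc k) → Fin q) → Carrier
    summand es φ = prodF F (map (λ u → α (φ u)) (allFin (ℕ.suc k)))
                 * prodF F (map (λ e → β (φ (proj₁ e)) (φ (proj₂ e))) es)

    leaves : Fin q → (Fin k → Fin q) → Carrier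
    leaves x f = ∏ (λ j → α (f j) * β x (f j))

    summand-factors : ∀ f x → summand (spokes k) (x ∷ᶠ f) ≈ α x * leaves x f
    summand-factors f x = begin
      summand (spokes k) (x ∷ᶠ f)                     ≡⟨ ≡.cong₂ _*_ (foldr-map-allFin _*_ 1# (α ∘ φ)) spoke-weights ⟩
      (α x * ∏ (λ j → α (f j))) * ∏ (λ j → β x (f j)) ≈⟨ *-assoc (α x) _ _ ⟩
      α x * (∏ (λ j → α (f j)) * ∏ (λ j → β x (f j))) ≈⟨ *-congˡ (∏-distrib-* (λ j → α (f j)) (λ j → β x (f j))) ⟨
      α x * leaves x f                              ∎
      where
      φ : Fin (ℕ.suc k) → Fin q
      φ = x ∷ᶠ f
      spoke-weights : prodF F (map (λ e → β (φ (proj₁ e)) (φ (proj₂ e))) (spokes k)) ≡ ∏ (λ j → β x (f j))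
      spoke-weights = ≡.trans (≡.cong (prodF F) (map-tabulate (λ j → (zero , suc j)) (λ e → β (φ (proj₁ e)) (φ (proj₂ e)))))
                              (foldr-tabulate _*_ 1# (λ j → β x (f j)))

    centred-at : ∀ x → sumˡ (map (λ f → α x * leaves x f) (allFuns k q)) ≈ α x * weightedDegree H x ^ k
    centred-at x = begin
      sumˡ (map (λ f → α x * leaves x f) (allFuns k q)) ≈⟨ *-distribˡ-sumˡ (α x) (leaves x) (allFuns k q) ⟨
      α x * sumˡ (map (leaves x) (allFuns k q))         ≈⟨ *-congˡ (sumˡ-allFuns-∏ k {q} (λ _ y → α y * β x y)) ⟩
      α x * ∏ (λ (_ : Fin k) → weightedDegree H x)      ≈⟨ *-congˡ (∏-const k {weightedDegree H x}) ⟩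
      α x * weightedDegree H x ^ k                      ∎

theorem4p6 : ∀ {c ℓ : Level} (F : Field c ℓ) → CharZero F →
    (d : ℕ) → d ≥ 1 →
    ¬ Σ (WeightedGraph F) (λ H → ∀ (G : SimpleGraph) → Field._≈_ F (ec F d G) (hom F G H))
theorem4p6 F char0 (ℕ.suc d) _ (H , ec≈hom) =
  powerSum-vanishes F α (weightedDegree F H) (ℕ.suc d) overfull-stars 0 (char0 d ∘ one-edge-star)
  where
  open Field F
  open WeightedGraph H

  ec-star : ∀ k → natF F (ecℕ (star k) (ℕ.suc d)) ≈ powerSum F α (weightedDegree F H) k
  ec-star k = trans (ec≈hom (star k)) (hom-star F k H)

  overfull-stars : ∀ j → powerSum F α (weightedDegree F H) (ℕ.suc (ℕ.suc d ℕ.+ j)) ≈ 0#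
  overfull-stars j = trans (sym (ec-star (ℕ.suc (ℕ.suc d ℕ.+ j))))
                           (reflexive (≡.cong (natF F) (ecℕ-star-overfull (s≤s (ℕₚ.m≤m+n (ℕ.suc d) j)))))

  one-edge-star : powerSum F α (weightedDegree F H) 1 ≈ 0# → natF F (ℕ.suc d) ≈ 0#
  one-edge-star p₁≈0 = trans (reflexive (≡.cong (natF F) (≡.sym (ecℕ-star-one (ℕ.suc d)))))
                             (trans (ec-star 1) p₁≈0)
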